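{- Let $c>1$ be an integer. The number of positive integers $n$ of the form $n=p^aq^b$, with $p\ne q$ primes and $a,b\ge 1$, satisfying $n-\varphi(n)=c$ is $$G(c+1)+O(\ln^2 c).$$
   Context: $\varphi$ denotes Euler's totient function. For a positive integer $k$, $G(k)$ denotes the number of ways to represent $k$ as a sum of two primes. -}

module Defs where

open import Data.Nat using (ℕ; zero; suc; _+_; _*_; _∸_; _^_; _≤_; _<_; _≟_)
open import Data.Nat.GCD using (gcd)
open import Data.Nat.Primality using (Prime; prime?)
open import Data.List using (List; length; filter; upTo; map; applyUpTo)
open import Data.Product using (∃; _×_; _,_)
open import Relation.Nullary using (¬_; _×-dec_)
open import Relation.Binary.PropositionalEquality using (_≡_)

φ : ℕ → ℕ
φ n = length (filter (λ k → gcd k n ≟ 1) (applyUpTo suc n))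

-- G k = number of ways to write k = p + q with p, q prime,
-- counted as unordered pairs, i.e. pairs with p ≤ q.
-- (p ranges over 0..k; q is then k ∸ p.)
G : ℕ → ℕ
G k = length (filter (λ p → (prime? p ×-dec prime? (k ∸ p)) ×-dec (Data.Nat._≤?_ (p + p) k))
                     (upTo (suc k)))

TwoPrimePower : ℕ → Set
TwoPrimePower n = ∃ λ p → ∃ λ q → ∃ λ a → ∃ λ b →
  Prime p × Prime q × ¬ (p ≡ q) × 1 ≤ a × 1 ≤ b × n ≡ p ^ a * q ^ b

Sol : ℕ → ℕ → Set
Sol c n = 1 ≤ n × TwoPrimePower n × n ∸ φ n ≡ c

{-# OPTIONS --safe #-}
-- Inclusion-exclusion over the multiples of p and q in [1, n] gives
-- n - φ(n) = p^a q^b (p + q - 1) for n = p^(a+1) q^(b+1).  So a solution of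
-- n - φ(n) = c is determined by little data: if a = b = 0, by its smaller prime p,
-- where c + 1 = p + q is a Goldbach decomposition; if only a > 0, by the prime
-- divisor p of c and the exponent a ≤ log₂ c; if a, b > 0, by the prime divisors
-- p, q of c.  As c has at most log₂ c prime divisors, the solutions inject into
-- G(c + 1) Goldbach labels and O(log² c) further labels.  Conversely every decomposition c + 1 = p + q
-- with p < q yields the solution pq, and at most one decomposition has p = q.
module Submission where

open import Defs
open import Data.Nat
open import Data.Nat.Properties
open import Data.Nat.Divisibility
open import Data.Nat.Coprimality using (Coprime; coprime-divisor; coprime⇒gcd≡1)
open import Data.Nat.GCD using (gcd; gcd-greatest)
open import Data.Nat.Primality
open import Data.Nat.Logarithm using (⌊log₂_⌋; ⌊log₂⌋-mono-≤; ⌊log₂[2^n]⌋≡n)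
open import Data.Nat.Tactic.RingSolver using (solve-∀)
open import Data.List using (List; []; _∷_; [_]; _++_; _∷ʳ_; length; filter; map; applyUpTo; upTo; cartesianProductWith)
open import Data.List.Properties using (length-upTo; length-map; length-applyUpTo; applyUpTo-∷ʳ; filter-++; length-++; filter-≐; filter-accept; filter-reject)
open import Data.List.Membership.Propositional using (_∈_)
open import Data.List.Membership.Propositional.Properties using (∈-∃++; ∈-++⁻; ∈-++⁺ˡ; ∈-++⁺ʳ; ∈-filter⁺; ∈-filter⁻; ∈-upTo⁺; ∈-map⁺; ∈-cartesianProductWith⁺)
open import Data.List.Relation.Unary.All as All using (All; _∷_)
open import Data.List.Relation.Unary.AllPairs using (_∷_)
open import Data.List.Relation.Unary.Any using (here; there)
open import Data.List.Relation.Unary.All.Properties using (all-filter)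
open import Data.List.Relation.Unary.Unique.Propositional using (Unique)
import Data.List.Relation.Unary.Unique.Propositional.Properties as Unique
open import Data.Product using (∃; _×_; _,_)
open import Data.Sum using (_⊎_; inj₁; inj₂)
open import Data.Empty using (⊥-elim)
open import Function using (_∘_)
open import Function.Bundles using (_⇔_; Equivalence)
open import Level using (0ℓ)
open import Relation.Nullary using (¬_; yes; no; _×-dec_)
open import Relation.Unary using (Pred; Decidable; ∁; _≐_)
open import Relation.Unary.Properties using (∁?; _∪?_; _∩?_)
open import Relation.Binary.PropositionalEquality hiding ([_])

module _ {A : Set} {P : Pred A 0ℓ} (P? : Decidable P) where

  length-filter-∁ : ∀ xs → length (filter P? xs) + length (filter (∁? P?) xs) ≡ length xs
  length-filter-∁ [] = refl
  length-filter-∁ (x ∷ xs) with P? x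
  ... | yes _ = cong suc (length-filter-∁ xs)
  ... | no _ = trans (+-suc _ _) (cong suc (length-filter-∁ xs))

module _ {A : Set} {P Q : Pred A 0ℓ} (P? : Decidable P) (Q? : Decidable Q) where

  length-filter-∪-∩ : ∀ xs → length (filter (P? ∪? Q?) xs) + length (filter (P? ∩? Q?) xs)
                           ≡ length (filter P? xs) + length (filter Q? xs)
  length-filter-∪-∩ [] = refl
  length-filter-∪-∩ (x ∷ xs) with P? x | Q? x
  ... | yes _ | yes _ = cong suc (trans (+-suc _ _) (trans (cong suc (length-filter-∪-∩ xs)) (sym (+-suc _ _))))
  ... | yes _ | no _ = cong suc (length-filter-∪-∩ xs)
  ... | no _ | yes _ = trans (cong suc (length-filter-∪-∩ xs)) (sym (+-suc _ _))
  ... | no _ | no _ = length-filter-∪-∩ xs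

  length-filter-≐ : P ≐ Q → ∀ xs → length (filter P? xs) ≡ length (filter Q? xs)
  length-filter-≐ P≐Q xs = cong length (filter-≐ P? Q? P≐Q xs)

module _ {A B : Set} (R : A → B → Set) (R-injective : ∀ {x x′ y} → R x y → R x′ y → x ≡ x′) where

  length-≤-by-injection : ∀ {xs ys} → Unique xs → (∀ {x} → x ∈ xs → ∃ λ y → y ∈ ys × R x y) →
                          length xs ≤ length ys
  length-≤-by-injection {[]} _ _ = z≤n
  length-≤-by-injection {x ∷ xs} (x∉xs ∷ xs-unique) cover
    with y , y∈ys , Rxy ← cover (here refl)
    with ys₁ , ys₂ , refl ← ∈-∃++ y∈ys = begin
      suc (length xs)                 ≤⟨ s≤s (length-≤-by-injection xs-unique cover′) ⟩
      suc (length (ys₁ ++ ys₂))       ≡⟨ cong suc (length-++ ys₁) ⟩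
      suc (length ys₁ + length ys₂)   ≡⟨ +-suc (length ys₁) _ ⟨
      length ys₁ + suc (length ys₂)   ≡⟨ length-++ ys₁ ⟨
      length (ys₁ ++ y ∷ ys₂)         ∎
    where
    open ≤-Reasoning
    cover′ : ∀ {x′} → x′ ∈ xs → ∃ λ y′ → y′ ∈ ys₁ ++ ys₂ × R x′ y′
    cover′ x′∈xs with y′ , y′∈ys , Rx′y′ ← cover (there x′∈xs) with ∈-++⁻ ys₁ y′∈ys
    ... | inj₁ y′∈ys₁         = y′ , ∈-++⁺ˡ y′∈ys₁ , Rx′y′
    ... | inj₂ (here refl)    = ⊥-elim (All.lookup x∉xs x′∈xs (R-injective Rxy Rx′y′))
    ... | inj₂ (there y′∈ys₂) = y′ , ∈-++⁺ʳ ys₁ y′∈ys₂ , Rx′y′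

length-cartesianProductWith : ∀ {A B C : Set} (f : A → B → C) xs ys →
                              length (cartesianProductWith f xs ys) ≡ length xs * length ys
length-cartesianProductWith f []       ys = refl
length-cartesianProductWith f (x ∷ xs) ys =
  trans (length-++ (map (f x) ys)) (cong₂ _+_ (length-map (f x) ys) (length-cartesianProductWith f xs ys))

m*m+m*[1+n]≤3*[n*n] : ∀ {m n} → m ≤ n → 1 ≤ n → m * m + m * suc n ≤ 3 * (n * n)
m*m+m*[1+n]≤3*[n*n] {m} {n} m≤n 1≤n = begin
  m * m + m * suc n       ≤⟨ +-mono-≤ (*-mono-≤ m≤n m≤n) (*-monoˡ-≤ (suc n) m≤n) ⟩
  n * n + n * suc n       ≡⟨ cong (n * n +_) (*-suc n n) ⟩
  n * n + (n + n * n)     ≤⟨ +-monoʳ-≤ (n * n) (+-monoˡ-≤ (n * n) (m≤m*n n n {{>-nonZero 1≤n}})) ⟩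
  n * n + (n * n + n * n) ≡⟨ cong (λ x → n * n + (n * n + x)) (+-identityʳ (n * n)) ⟨
  3 * (n * n)             ∎
  where open ≤-Reasoning

m+m≡n+n⇒m≡n : ∀ {m n} → m + m ≡ n + n → m ≡ n
m+m≡n+n⇒m≡n {m} {n} eq = *-cancelˡ-≡ m n 2 (begin
  m + (m + 0) ≡⟨ cong (m +_) (+-identityʳ m) ⟩
  m + m       ≡⟨ eq ⟩
  n + n       ≡⟨ cong (n +_) (+-identityʳ n) ⟨
  n + (n + 0) ∎)
  where open ≡-Reasoning

2^e≤n⇒e≤⌊log₂n⌋ : ∀ {e n} → 2 ^ e ≤ n → e ≤ ⌊log₂ n ⌋
2^e≤n⇒e≤⌊log₂n⌋ {e} 2^e≤n = subst (_≤ _) (⌊log₂[2^n]⌋≡n e) (⌊log₂⌋-mono-≤ 2^e≤n)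

countUpTo : {P : Pred ℕ 0ℓ} → Decidable P → ℕ → ℕ
countUpTo P? n = length (filter P? (applyUpTo suc n))

module _ {P : Pred ℕ 0ℓ} (P? : Decidable P) where

  countUpTo-suc : ∀ n → countUpTo P? (suc n) ≡ countUpTo P? n + length (filter P? [ suc n ])
  countUpTo-suc n = begin
    length (filter P? (applyUpTo suc (suc n)))                  ≡⟨ cong (length ∘ filter P?) (applyUpTo-∷ʳ suc n) ⟨
    length (filter P? (applyUpTo suc n ∷ʳ suc n))               ≡⟨ cong length (filter-++ P? (applyUpTo suc n) [ suc n ]) ⟩
    length (filter P? (applyUpTo suc n) ++ filter P? [ suc n ]) ≡⟨ length-++ (filter P? (applyUpTo suc n)) ⟩
    countUpTo P? n + length (filter P? [ suc n ])               ∎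
    where open ≡-Reasoning

  countUpTo-suc-accept : ∀ {n} → P (suc n) → countUpTo P? (suc n) ≡ suc (countUpTo P? n)
  countUpTo-suc-accept {n} p = trans (countUpTo-suc n)
    (trans (cong ((countUpTo P? n +_) ∘ length) (filter-accept P? {xs = []} p)) (+-comm _ 1))

  countUpTo-suc-reject : ∀ {n} → ¬ P (suc n) → countUpTo P? (suc n) ≡ countUpTo P? n
  countUpTo-suc-reject {n} ¬p = trans (countUpTo-suc n)
    (trans (cong ((countUpTo P? n +_) ∘ length) (filter-reject P? {xs = []} ¬p)) (+-identityʳ _))

module _ (d : ℕ) .{{_ : NonZero d}} where

  countUpTo-∣-*+ : ∀ m j → j < d → countUpTo (d ∣?_) (m * d + j) ≡ m
  countUpTo-∣-*+ zero zero _ = refl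
  countUpTo-∣-*+ (suc m) zero _ = begin
    countUpTo (d ∣?_) (suc m * d + 0)          ≡⟨ cong (countUpTo (d ∣?_)) [1+m]*d+0≡1+[m*d+pred[d]] ⟩
    countUpTo (d ∣?_) (suc (m * d + pred d))   ≡⟨ countUpTo-suc-accept (d ∣?_) d∣ ⟩
    suc (countUpTo (d ∣?_) (m * d + pred d))   ≡⟨ cong suc (countUpTo-∣-*+ m (pred d) (subst (pred d <_) (suc-pred d) (n<1+n (pred d)))) ⟩
    suc m                                       ∎
    where
    open ≡-Reasoning
    [1+m]*d+0≡1+[m*d+pred[d]] : suc m * d + 0 ≡ suc (m * d + pred d)
    [1+m]*d+0≡1+[m*d+pred[d]] = begin
      suc m * d + 0       ≡⟨ +-identityʳ _ ⟩
      d + m * d           ≡⟨ +-comm d (m * d) ⟩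
      m * d + d           ≡⟨ cong (m * d +_) (suc-pred d) ⟨
      m * d + suc (pred d) ≡⟨ +-suc (m * d) (pred d) ⟩
      suc (m * d + pred d) ∎
    d∣ : d ∣ suc (m * d + pred d)
    d∣ = subst (d ∣_) [1+m]*d+0≡1+[m*d+pred[d]] (divides (suc m) (+-identityʳ _))
  countUpTo-∣-*+ m (suc j) j<d = begin
    countUpTo (d ∣?_) (m * d + suc j)   ≡⟨ cong (countUpTo (d ∣?_)) (+-suc (m * d) j) ⟩
    countUpTo (d ∣?_) (suc (m * d + j)) ≡⟨ countUpTo-suc-reject (d ∣?_) d∤ ⟩
    countUpTo (d ∣?_) (m * d + j)       ≡⟨ countUpTo-∣-*+ m j (<-trans (n<1+n j) j<d) ⟩
    m                                   ∎
    where
    open ≡-Reasoning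
    d∤ : ¬ d ∣ suc (m * d + j)
    d∤ d∣ = <⇒≱ j<d (∣⇒≤ (∣m+n∣m⇒∣n (subst (d ∣_) (sym (+-suc (m * d) j)) d∣) (n∣m*n m)))

  countUpTo-∣-* : ∀ m → countUpTo (d ∣?_) (m * d) ≡ m
  countUpTo-∣-* m = trans (cong (countUpTo (d ∣?_)) (sym (+-identityʳ (m * d))))
                          (countUpTo-∣-*+ m 0 (>-nonZero⁻¹ d))

prime∣prime⇒≡ : ∀ {r p} → Prime r → Prime p → r ∣ p → r ≡ p
prime∣prime⇒≡ r-prime p-prime r∣p with prime⇒irreducible p-prime r∣p
... | inj₁ refl = ⊥-elim (¬prime[1] r-prime)
... | inj₂ r≡p = r≡p

prime∤1 : ∀ {p} → Prime p → ¬ p ∣ 1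
prime∤1 p-prime p∣1 = ¬prime[1] (subst Prime (∣1⇒≡1 p∣1) p-prime)

prime⇒2≤ : ∀ {p} → Prime p → 2 ≤ p
prime⇒2≤ {p} p-prime = nonTrivial⇒n>1 p {{prime⇒nonTrivial p-prime}}

prime⇒1<p+q : ∀ {p} → Prime p → ∀ q → 1 < p + q
prime⇒1<p+q {p} p-prime q = ≤-trans (prime⇒2≤ p-prime) (m≤m+n p q)

semiprime-smaller-factor-unique : ∀ {p q p′ q′} → Prime p → Prime q → Prime p′ → Prime q′ →
                                  p ≤ q → p′ ≤ q′ → p * q ≡ p′ * q′ → p ≡ p′
semiprime-smaller-factor-unique {p} {q} {p′} {q′} p-prime q-prime p′-prime q′-prime p≤q p′≤q′ pq≡p′q′
  with euclidsLemma p′ q′ p-prime (subst (p ∣_) pq≡p′q′ (m∣m*n q))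
... | inj₁ p∣p′ = prime∣prime⇒≡ p-prime p′-prime p∣p′
... | inj₂ p∣q′ with euclidsLemma p q p′-prime (subst (p′ ∣_) (sym pq≡p′q′) (m∣m*n q′))
...   | inj₁ p′∣p = sym (prime∣prime⇒≡ p′-prime p-prime p′∣p)
...   | inj₂ p′∣q = ≤-antisym (≤-trans p≤q (≤-reflexive (sym (prime∣prime⇒≡ p′-prime q-prime p′∣q))))
                              (≤-trans p′≤q′ (≤-reflexive (sym (prime∣prime⇒≡ p-prime q′-prime p∣q′))))

prime-∤⇒coprime : ∀ {k p} → Prime p → ¬ p ∣ k → Coprime k p
prime-∤⇒coprime p-prime p∤k (i∣k , i∣p) with prime⇒irreducible p-prime i∣p
... | inj₁ i≡1 = i≡1
... | inj₂ refl = ⊥-elim (p∤k i∣k)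

coprime-* : ∀ {k m o} → Coprime k m → Coprime k o → Coprime k (m * o)
coprime-* k⊥m k⊥o (i∣k , i∣mo) = k⊥o (i∣k , coprime-divisor i⊥m i∣mo)
  where
  i⊥m : Coprime _ _
  i⊥m (j∣i , j∣m) = k⊥m (∣-trans j∣i i∣k , j∣m)

coprime-^ : ∀ {k m} e → Coprime k m → Coprime k (m ^ e)
coprime-^ zero    _   (_ , i∣1) = ∣1⇒≡1 i∣1
coprime-^ (suc e) k⊥m = coprime-* k⊥m (coprime-^ e k⊥m)

cototient : ℕ → ℕ
cototient n = n ∸ φ n

module _ {p q} (p-prime : Prime p) (q-prime : Prime q) (p≢q : p ≢ q) where

  ∣∩∣≐*∣ : (λ k → p ∣ k × q ∣ k) ≐ (p * q ∣_)
  ∣∩∣≐*∣ = both⇒product , λ pq∣k → m*n∣⇒m∣ p q pq∣k , m*n∣⇒n∣ p q pq∣k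
    where
    both⇒product : ∀ {k} → p ∣ k × q ∣ k → p * q ∣ k
    both⇒product (divides x refl , q∣xp) with euclidsLemma x p q-prime q∣xp
    ... | inj₁ (divides y refl) = divides y (reorder y q p)
      where reorder : ∀ y q p → y * q * p ≡ y * (p * q)
            reorder = solve-∀
    ... | inj₂ q∣p = ⊥-elim (p≢q (sym (prime∣prime⇒≡ q-prime p-prime q∣p)))

  module _ (a b : ℕ) where

    private
      n M : ℕ
      n = p ^ suc a * q ^ suc b
      M = p ^ a * q ^ b

    coprime≐∁∣∪∣ : (λ k → gcd k n ≡ 1) ≐ ∁ (λ k → p ∣ k ⊎ q ∣ k)
    coprime≐∁∣∪∣ = coprime⇒∤ , ∤⇒coprime
      where
      coprime⇒∤ : ∀ {k} → gcd k n ≡ 1 → ¬ (p ∣ k ⊎ q ∣ k)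
      coprime⇒∤ gcd≡1 (inj₁ p∣k) = prime∤1 p-prime (subst (p ∣_) gcd≡1 (gcd-greatest p∣k p∣n))
        where p∣n : p ∣ n
              p∣n = ∣m⇒∣m*n (q ^ suc b) (m∣m*n (p ^ a))
      coprime⇒∤ gcd≡1 (inj₂ q∣k) = prime∤1 q-prime (subst (q ∣_) gcd≡1 (gcd-greatest q∣k q∣n))
        where q∣n : q ∣ n
              q∣n = ∣n⇒∣m*n (p ^ suc a) (m∣m*n (q ^ b))
      ∤⇒coprime : ∀ {k} → ¬ (p ∣ k ⊎ q ∣ k) → gcd k n ≡ 1
      ∤⇒coprime p,q∤k = coprime⇒gcd≡1 (coprime-* (coprime-^ (suc a) (prime-∤⇒coprime p-prime (p,q∤k ∘ inj₁)))
                                                 (coprime-^ (suc b) (prime-∤⇒coprime q-prime (p,q∤k ∘ inj₂))))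

    cototient-twoPrimePower : cototient n + M ≡ M * (p + q)
    cototient-twoPrimePower = begin
      n ∸ φ n + M             ≡⟨ cong (λ z → n ∸ z + M) φn≡#∁D ⟩
      n ∸ #∁D + M             ≡⟨ cong (λ z → z ∸ #∁D + M) n≡#D+#∁D ⟩
      #D + #∁D ∸ #∁D + M      ≡⟨ cong (_+ M) (m+n∸n≡m #D #∁D) ⟩
      #D + M                  ≡⟨ cong (#D +_) (multiples (p * q) M (n≡M*pq p q (p ^ a) (q ^ b))) ⟨
      #D + countUpTo (p * q ∣?_) n
                              ≡⟨ cong (#D +_) (length-filter-≐ _ _ ∣∩∣≐*∣ xs) ⟨
      #D + length (filter ((p ∣?_) ∩? (q ∣?_)) xs)
                              ≡⟨ length-filter-∪-∩ (p ∣?_) (q ∣?_) xs ⟩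
      countUpTo (p ∣?_) n + countUpTo (q ∣?_) n
                              ≡⟨ cong₂ _+_ (multiples p (q * M) (n≡qM*p p q (p ^ a) (q ^ b)))
                                           (multiples q (p * M) (n≡pM*q p q (p ^ a) (q ^ b))) ⟩
      q * M + p * M           ≡⟨ distrib q p M ⟩
      M * (p + q)             ∎
      where
      open ≡-Reasoning
      instance
        _ = prime⇒nonZero p-prime
        _ = prime⇒nonZero q-prime
        _ = m*n≢0 p q
      xs : List ℕ
      xs = applyUpTo suc n
      #D #∁D : ℕ
      #D  = length (filter ((p ∣?_) ∪? (q ∣?_)) xs)
      #∁D = length (filter (∁? ((p ∣?_) ∪? (q ∣?_))) xs)
      φn≡#∁D : φ n ≡ #∁D
      φn≡#∁D = length-filter-≐ _ _ coprime≐∁∣∪∣ xs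
      n≡#D+#∁D : n ≡ #D + #∁D
      n≡#D+#∁D = trans (sym (length-applyUpTo suc n)) (sym (length-filter-∁ ((p ∣?_) ∪? (q ∣?_)) xs))
      multiples : ∀ d .{{_ : NonZero d}} m → n ≡ m * d → countUpTo (d ∣?_) n ≡ m
      multiples d m n≡m*d = trans (cong (countUpTo (d ∣?_)) n≡m*d) (countUpTo-∣-* d m)
      n≡qM*p : ∀ p q A B → p * A * (q * B) ≡ q * (A * B) * p
      n≡qM*p = solve-∀
      n≡pM*q : ∀ p q A B → p * A * (q * B) ≡ p * (A * B) * q
      n≡pM*q = solve-∀
      n≡M*pq : ∀ p q A B → p * A * (q * B) ≡ A * B * (p * q)
      n≡M*pq = solve-∀
      distrib : ∀ q p M → q * M + p * M ≡ M * (p + q)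
      distrib = solve-∀

2^length≤-distinctPrimeDivisors : ∀ {c} .{{_ : NonZero c}} {rs} → Unique rs → All (λ r → Prime r × r ∣ c) rs →
                          2 ^ length rs ≤ c
2^length≤-distinctPrimeDivisors {c} {[]} _ _ = >-nonZero⁻¹ c
2^length≤-distinctPrimeDivisors {rs = r ∷ rs} (r∉rs ∷ rs-unique) ((r-prime , divides c′ refl) ∷ rs-divide) =
  begin
    2 * 2 ^ length rs  ≤⟨ *-mono-≤ (prime⇒2≤ r-prime) ih ⟩
    r * c′             ≡⟨ *-comm r c′ ⟩
    c′ * r             ∎
  where
  open ≤-Reasoning
  instance _ = m*n≢0⇒m≢0 c′
  ih : 2 ^ length rs ≤ c′
  ih = 2^length≤-distinctPrimeDivisors rs-unique (All.zipWith divides-c′ (r∉rs , rs-divide))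
    where
    divides-c′ : ∀ {s} → r ≢ s × (Prime s × s ∣ c′ * r) → Prime s × s ∣ c′
    divides-c′ (r≢s , s-prime , s∣c′r) with euclidsLemma c′ r s-prime s∣c′r
    ... | inj₁ s∣c′ = s-prime , s∣c′
    ... | inj₂ s∣r  = ⊥-elim (r≢s (sym (prime∣prime⇒≡ s-prime r-prime s∣r)))

primeDivisor? : ∀ c → Decidable (λ r → Prime r × r ∣ c)
primeDivisor? c r = prime? r ×-dec r ∣? c

primeDivisors : ℕ → List ℕ
primeDivisors c = filter (primeDivisor? c) (upTo (suc c))

module _ {c : ℕ} .{{_ : NonZero c}} where

  ∈-primeDivisors⁺ : ∀ {r} → Prime r → r ∣ c → r ∈ primeDivisors c
  ∈-primeDivisors⁺ r-prime r∣c = ∈-filter⁺ (primeDivisor? c) (∈-upTo⁺ (s≤s (∣⇒≤ r∣c))) (r-prime , r∣c)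

  length-primeDivisors≤⌊log₂⌋ : length (primeDivisors c) ≤ ⌊log₂ c ⌋
  length-primeDivisors≤⌊log₂⌋ = 2^e≤n⇒e≤⌊log₂n⌋ (2^length≤-distinctPrimeDivisors
    (Unique.filter⁺ (primeDivisor? c) (Unique.upTo⁺ (suc c)))
    (all-filter (primeDivisor? c) (upTo (suc c))))

record Factorised (c n : ℕ) : Set where
  constructor factorised
  field
    {p q a b} : ℕ
    p-prime   : Prime p
    q-prime   : Prime q
    n≡        : n ≡ p ^ suc a * q ^ suc b
    c≡        : c ≡ pred (p + q) * (p ^ a * q ^ b)

sol⇒factorised : ∀ {c n} → Sol c n → Factorised c n
sol⇒factorised (_ , (p , q , suc a , suc b , p-prime , q-prime , p≢q , _ , _ , refl) , refl) =
  factorised {a = a} {b = b} p-prime q-prime refl (+-cancelʳ-≡ M _ _ (begin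
    cototient n + M             ≡⟨ cototient-twoPrimePower p-prime q-prime p≢q a b ⟩
    M * (p + q)                 ≡⟨ cong (M *_) (suc-pred (p + q)) ⟨
    M * suc (pred (p + q))      ≡⟨ *-suc M (pred (p + q)) ⟩
    M + M * pred (p + q)        ≡⟨ +-comm M _ ⟩
    M * pred (p + q) + M        ≡⟨ cong (_+ M) (*-comm M (pred (p + q))) ⟩
    pred (p + q) * M + M        ∎))
  where
  open ≡-Reasoning
  instance _ = >-nonZero (<⇒≤ (prime⇒1<p+q p-prime q))
  M n : ℕ
  M = p ^ a * q ^ b
  n = p ^ suc a * q ^ suc b

swap : ∀ {c n} → Factorised c n → Factorised c n
swap (factorised {p} {q} {a} {b} p-prime q-prime n≡ c≡) = factorised {a = b} {b = a} q-prime p-prime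
  (trans n≡ (*-comm (p ^ suc a) (q ^ suc b)))
  (trans c≡ (cong₂ _*_ (cong pred (+-comm p q)) (*-comm (p ^ a) (q ^ b))))

semiprime-sol : ∀ {c p q} → Prime p → Prime q → p ≢ q → p + q ≡ c + 1 → Sol c (p * q)
semiprime-sol {c} {p} {q} p-prime q-prime p≢q p+q≡c+1 =
  >-nonZero⁻¹ (p * q) ,
  (p , q , 1 , 1 , p-prime , q-prime , p≢q , ≤-refl , ≤-refl , pq≡p¹q¹) ,
  +-cancelʳ-≡ 1 _ _ (begin
    cototient (p * q) + 1       ≡⟨ cong (λ n → cototient n + 1) pq≡p¹q¹ ⟩
    cototient (p ^ 1 * q ^ 1) + 1 ≡⟨ cototient-twoPrimePower p-prime q-prime p≢q 0 0 ⟩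
    1 * (p + q)                 ≡⟨ *-identityˡ (p + q) ⟩
    p + q                       ≡⟨ p+q≡c+1 ⟩
    c + 1                       ∎)
  where
  open ≡-Reasoning
  instance
    _ = prime⇒nonZero p-prime
    _ = prime⇒nonZero q-prime
    _ = m*n≢0 p q
  pq≡p¹q¹ : p * q ≡ p ^ 1 * q ^ 1
  pq≡p¹q¹ = sym (cong₂ _*_ (*-identityʳ p) (*-identityʳ q))

GoldbachPrime : ℕ → ℕ → Set
GoldbachPrime k p = (Prime p × Prime (k ∸ p)) × p + p ≤ k

goldbachPrime? : ∀ k → Decidable (GoldbachPrime k)
goldbachPrime? k p = (prime? p ×-dec prime? (k ∸ p)) ×-dec (p + p ≤? k)

goldbachPrimes : ℕ → List ℕ
goldbachPrimes k = filter (goldbachPrime? k) (upTo (suc k))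

data Label : Set where
  goldbach   : ℕ → Label
  primePair  : ℕ → ℕ → Label
  primePower : ℕ → ℕ → Label

module UpperBound (c : ℕ) (1<c : 1 < c) where

  private instance
    c≢0 : NonZero c
    c≢0 = >-nonZero (<-trans z<s 1<c)

  _labelledBy_ : ℕ → Label → Set
  n labelledBy goldbach p     = n ≡ p * (c + 1 ∸ p)
  n labelledBy primePair p q  = Prime p × n * pred (p + q) ≡ c * (p * q)
  n labelledBy primePower p e = Prime p × ∃ λ q → c ≡ pred (p + q) * p ^ e × n ≡ p ^ suc e * q

  labelledBy-injective : ∀ {n n′ ℓ} → n labelledBy ℓ → n′ labelledBy ℓ → n ≡ n′
  labelledBy-injective {ℓ = goldbach p} n≡ n′≡ = trans n≡ (sym n′≡)
  labelledBy-injective {n} {n′} {primePair p q} (p-prime , n≡) (_ , n′≡) =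
    *-cancelʳ-≡ n n′ (pred (p + q)) {{>-nonZero (<⇒≤pred (prime⇒1<p+q p-prime q))}} (trans n≡ (sym n′≡))
  labelledBy-injective {ℓ = primePower p e} (p-prime , q , c≡ , n≡) (_ , q′ , c≡′ , n′≡) =
    trans n≡ (trans (cong (p ^ suc e *_) q≡q′) (sym n′≡))
    where
    instance
      _ = prime⇒nonZero p-prime
      _ = m^n≢0 p e
      _ = >-nonZero (<⇒≤ (prime⇒1<p+q p-prime q))
      _ = >-nonZero (<⇒≤ (prime⇒1<p+q p-prime q′))
    q≡q′ : q ≡ q′
    q≡q′ = +-cancelˡ-≡ p q q′ (pred-injective (*-cancelʳ-≡ _ _ (p ^ e) (trans (sym c≡) c≡′)))

  L : ℕ
  L = ⌊log₂ c ⌋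

  goldbachLabels primePairLabels primePowerLabels labels : List Label
  goldbachLabels   = map goldbach (goldbachPrimes (c + 1))
  primePairLabels  = cartesianProductWith primePair (primeDivisors c) (primeDivisors c)
  primePowerLabels = cartesianProductWith primePower (primeDivisors c) (upTo (suc L))
  labels           = goldbachLabels ++ primePairLabels ++ primePowerLabels

  Labelled : ℕ → Set
  Labelled n = ∃ λ ℓ → ℓ ∈ labels × n labelledBy ℓ

  goldbach-label : ∀ {n} (f : Factorised c n) → Factorised.a f ≡ 0 → Factorised.b f ≡ 0 →
                   Factorised.p f ≤ Factorised.q f → Labelled n
  goldbach-label (factorised {p} {q} p-prime q-prime n≡ c≡) refl refl p≤q =
    goldbach p , ∈-++⁺ˡ (∈-map⁺ goldbach p∈goldbachPrimes) , trans n≡ (cong₂ _*_ (*-identityʳ p) q¹≡c+1∸p)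
    where
    instance _ = >-nonZero (<⇒≤ (prime⇒1<p+q p-prime q))
    p+q≡c+1 : p + q ≡ c + 1
    p+q≡c+1 = begin
      p + q                   ≡⟨ suc-pred (p + q) ⟨
      suc (pred (p + q))      ≡⟨ +-comm 1 _ ⟩
      pred (p + q) + 1        ≡⟨ cong (_+ 1) (trans c≡ (*-identityʳ _)) ⟨
      c + 1                   ∎
      where open ≡-Reasoning
    c+1∸p≡q : c + 1 ∸ p ≡ q
    c+1∸p≡q = trans (cong (_∸ p) (sym p+q≡c+1)) (m+n∸m≡n p q)
    q¹≡c+1∸p : q ^ 1 ≡ c + 1 ∸ p
    q¹≡c+1∸p = trans (*-identityʳ q) (sym c+1∸p≡q)
    p∈goldbachPrimes : p ∈ goldbachPrimes (c + 1)
    p∈goldbachPrimes = ∈-filter⁺ (goldbachPrime? (c + 1)) (∈-upTo⁺ (s≤s (subst (p ≤_) p+q≡c+1 (m≤m+n p q))))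
      ((p-prime , subst Prime (sym c+1∸p≡q) q-prime) , subst (p + p ≤_) p+q≡c+1 (+-monoʳ-≤ p p≤q))

  primePower-label : ∀ {n} (f : Factorised c n) → 1 ≤ Factorised.a f → Factorised.b f ≡ 0 → Labelled n
  primePower-label (factorised {p} {q} {suc e} p-prime _ n≡ c≡) _ refl =
    primePower p (suc e) ,
    ∈-++⁺ʳ goldbachLabels (∈-++⁺ʳ primePairLabels (∈-cartesianProductWith⁺ primePower (∈-primeDivisors⁺ p-prime p∣c) (∈-upTo⁺ (s≤s 1+e≤L)))) ,
    p-prime , q , c≡′ , trans n≡ (cong (p ^ suc (suc e) *_) (*-identityʳ q))
    where
    c≡′ : c ≡ pred (p + q) * p ^ suc e
    c≡′ = trans c≡ (cong (pred (p + q) *_) (*-identityʳ _))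
    p^[1+e]∣c : p ^ suc e ∣ c
    p^[1+e]∣c = divides (pred (p + q)) c≡′
    p∣c : p ∣ c
    p∣c = ∣-trans (m∣m*n (p ^ e)) p^[1+e]∣c
    1+e≤L : suc e ≤ L
    1+e≤L = 2^e≤n⇒e≤⌊log₂n⌋ (≤-trans (^-monoˡ-≤ (suc e) (prime⇒2≤ p-prime)) (∣⇒≤ p^[1+e]∣c))

  primePair-label : ∀ {n} (f : Factorised c n) → 1 ≤ Factorised.a f → 1 ≤ Factorised.b f → Labelled n
  primePair-label (factorised {p} {q} {suc a} {suc b} p-prime q-prime refl c≡) _ _ =
    primePair p q ,
    ∈-++⁺ʳ goldbachLabels (∈-++⁺ˡ (∈-cartesianProductWith⁺ primePair (∈-primeDivisors⁺ p-prime p∣c) (∈-primeDivisors⁺ q-prime q∣c))) ,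
    p-prime , trans (shuffle p q (p ^ suc a) (q ^ suc b) (pred (p + q))) (cong (_* (p * q)) (sym c≡))
    where
    shuffle : ∀ p q A B X → p * A * (q * B) * X ≡ X * (A * B) * (p * q)
    shuffle = solve-∀
    p∣c : p ∣ c
    p∣c = subst (p ∣_) (sym c≡) (∣n⇒∣m*n (pred (p + q)) (∣m⇒∣m*n (q ^ suc b) (m∣m*n (p ^ a))))
    q∣c : q ∣ c
    q∣c = subst (q ∣_) (sym c≡) (∣n⇒∣m*n (pred (p + q)) (∣n⇒∣m*n (p ^ suc a) (m∣m*n (q ^ b))))

  label : ∀ {n} → Factorised c n → Labelled n
  label f@(factorised {p} {q} {zero} {zero} _ _ _ _) with ≤-total p q
  ... | inj₁ p≤q = goldbach-label f refl refl p≤q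
  ... | inj₂ q≤p = goldbach-label (swap f) refl refl q≤p
  label f@(factorised {a = suc _} {b = zero}  _ _ _ _) = primePower-label f (s≤s z≤n) refl
  label f@(factorised {a = zero}  {b = suc _} _ _ _ _) = primePower-label (swap f) (s≤s z≤n) refl
  label f@(factorised {a = suc _} {b = suc _} _ _ _ _) = primePair-label f (s≤s z≤n) (s≤s z≤n)

  length-labels : length labels ≡ G (c + 1) + (length (primeDivisors c) * length (primeDivisors c)
                                              + length (primeDivisors c) * suc L)
  length-labels = begin
    length (goldbachLabels ++ primePairLabels ++ primePowerLabels)
      ≡⟨ length-++ goldbachLabels ⟩
    length goldbachLabels + length (primePairLabels ++ primePowerLabels)
      ≡⟨ cong₂ _+_ (length-map goldbach (goldbachPrimes (c + 1))) (length-++ primePairLabels) ⟩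
    G (c + 1) + (length primePairLabels + length primePowerLabels)
      ≡⟨ cong (G (c + 1) +_) (cong₂ _+_
           (length-cartesianProductWith primePair (primeDivisors c) (primeDivisors c))
           (trans (length-cartesianProductWith primePower (primeDivisors c) (upTo (suc L)))
                  (cong (length (primeDivisors c) *_) (length-upTo (suc L))))) ⟩
    G (c + 1) + (length (primeDivisors c) * length (primeDivisors c) + length (primeDivisors c) * suc L)
      ∎
    where open ≡-Reasoning

  length-solutions≤ : ∀ {S} → Unique S → (∀ {n} → n ∈ S → Sol c n) → length S ≤ G (c + 1) + 3 * (L * L)
  length-solutions≤ {S} S-unique S⊆Sol = begin
    length S          ≤⟨ length-≤-by-injection _labelledBy_ labelledBy-injective S-unique (label ∘ sol⇒factorised ∘ S⊆Sol) ⟩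
    length labels     ≡⟨ length-labels ⟩
    G (c + 1) + _     ≤⟨ +-monoʳ-≤ (G (c + 1)) (m*m+m*[1+n]≤3*[n*n] (length-primeDivisors≤⌊log₂⌋ {c}) 1≤L) ⟩
    G (c + 1) + 3 * (L * L) ∎
    where
    open ≤-Reasoning
    1≤L : 1 ≤ L
    1≤L = 2^e≤n⇒e≤⌊log₂n⌋ 1<c

module LowerBound (c : ℕ) where

  -- The decomposition c + 1 = p + p yields no solution; it is sent to 0 instead.
  _pairsWith_ : ℕ → ℕ → Set
  p pairsWith m = GoldbachPrime (c + 1) p × (p + p ≡ c + 1 × m ≡ 0 ⊎ m ≡ p * (c + 1 ∸ p))

  semiprime≢0 : ∀ {p} → GoldbachPrime (c + 1) p → p * (c + 1 ∸ p) ≢ 0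
  semiprime≢0 {p} ((p-prime , q-prime) , _) = ≢-nonZero⁻¹ _ {{m*n≢0 p _ {{prime⇒nonZero p-prime}} {{prime⇒nonZero q-prime}}}}

  pairsWith-injective : ∀ {p p′ m} → p pairsWith m → p′ pairsWith m → p ≡ p′
  pairsWith-injective (_ , inj₁ (p+p≡ , _)) (_ , inj₁ (p′+p′≡ , _)) = m+m≡n+n⇒m≡n (trans p+p≡ (sym p′+p′≡))
  pairsWith-injective (_ , inj₁ (_ , refl)) (g′ , inj₂ 0≡p′q′) = ⊥-elim (semiprime≢0 g′ (sym 0≡p′q′))
  pairsWith-injective (g , inj₂ 0≡pq) (_ , inj₁ (_ , refl)) = ⊥-elim (semiprime≢0 g (sym 0≡pq))
  pairsWith-injective (((p-prime , q-prime) , p+p≤) , inj₂ refl) (((p′-prime , q′-prime) , p′+p′≤) , inj₂ pq≡p′q′) =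
    semiprime-smaller-factor-unique p-prime q-prime p′-prime q′-prime
      (m+n≤o⇒m≤o∸n _ p+p≤) (m+n≤o⇒m≤o∸n _ p′+p′≤) pq≡p′q′

  length-goldbachPrimes≤ : ∀ {S} → (∀ {n} → Sol c n → n ∈ S) → G (c + 1) ≤ suc (length S)
  length-goldbachPrimes≤ {S} Sol⊆S =
    length-≤-by-injection _pairsWith_ pairsWith-injective (Unique.filter⁺ (goldbachPrime? (c + 1)) (Unique.upTo⁺ (suc (c + 1)))) pair
    where
    pair : ∀ {p} → p ∈ goldbachPrimes (c + 1) → ∃ λ m → m ∈ 0 ∷ S × p pairsWith m
    pair {p} p∈ with ∈-filter⁻ (goldbachPrime? (c + 1)) {xs = upTo (suc (c + 1))} p∈
    ... | _ , g@((p-prime , q-prime) , p+p≤) with p + p ≟ c + 1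
    ...   | yes p+p≡ = 0 , here refl , g , inj₁ (p+p≡ , refl)
    ...   | no  p+p≢ = p * (c + 1 ∸ p) , there (Sol⊆S (semiprime-sol p-prime q-prime p≢q (m+[n∸m]≡n p≤c+1))) , g , inj₂ refl
      where
      p≤c+1 : p ≤ c + 1
      p≤c+1 = ≤-trans (m≤m+n p p) p+p≤
      p≢q : p ≢ c + 1 ∸ p
      p≢q p≡q = p+p≢ (trans (cong (p +_) p≡q) (m+[n∸m]≡n p≤c+1))

lemma4p3 : ∃ λ (C : ℕ) → ∀ (c : ℕ) → 1 < c →
    ∀ (S : List ℕ) → Unique S → (∀ n → (n ∈ S) ⇔ Sol c n) →
      (length S ≤ G (c + 1) + C * (⌊log₂ c ⌋ * ⌊log₂ c ⌋)) ×
      (G (c + 1) ≤ length S + C * (⌊log₂ c ⌋ * ⌊log₂ c ⌋))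
lemma4p3 = 3 , λ c 1<c S S-unique S⇔Sol →
  let L = ⌊log₂ c ⌋
      1≤L : 1 ≤ L
      1≤L = 2^e≤n⇒e≤⌊log₂n⌋ 1<c
      open ≤-Reasoning
  in UpperBound.length-solutions≤ c 1<c S-unique (Equivalence.to (S⇔Sol _)) ,
     (begin
       G (c + 1)              ≤⟨ LowerBound.length-goldbachPrimes≤ c (Equivalence.from (S⇔Sol _)) ⟩
       suc (length S)         ≡⟨ +-comm 1 (length S) ⟩
       length S + 1           ≤⟨ +-monoʳ-≤ (length S) (≤-trans (*-mono-≤ 1≤L 1≤L) (m≤n*m (L * L) 3)) ⟩
       length S + 3 * (L * L) ∎)
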